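{- Let $K,S$ be finite sets, $F$ a finite family of finite sets, and let $P(K,S,F)=\{A\setminus K : A\in F,\ K\subseteq A\subseteq K\cup S\}$. Then: (1) if $K\cap S=\emptyset$ and $K'\subseteq K$, then $P(K',S,F)\subseteq\mathcal{P}(S)$; (2) if $F$ is union closed, then $P(K,S,F)$ is union closed; (3) if $F$ is union closed, $F_c\subseteq F$, $S=\bigcup F_c$ and $K\cap S=\emptyset$, then $P(K,S,F)$ is union closed for $F_c$; (4) if $w$ is a function to $\mathbb{N}$ with $w(x)=0$ for all $x\in K$, then for every finite set $X$, $\sum_{A\in F,\ K\subseteq A\subseteq K\cup S}\bigl(2w(A)-w(X)\bigr)=\sum_{B\in P(K,S,F)}\bigl(2w(B)-w(X)\bigr)$.
   Context: $w(A)=\sum_{a\in A}w(a)$; sums computed in the integers. A family $G$ is union closed if $A\cup B\in G$ for all $A,B\in G$; it is union closed for $G_c$ if it is union closed and $A\cup B\in G$ for all $A\in G$, $B\in G_c$. -}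

module Defs where

open import Data.Nat using (ℕ; zero; suc)
import Data.Nat as ℕ
open import Data.Integer as ℤ using (ℤ; +_)
open import Data.Bool using (Bool; true; false; if_then_else_; _∧_)
import Data.Bool.Properties as BoolP
open import Data.Fin using (Fin)
open import Data.Fin.Subset using (Subset; inside; outside; _⊆_; _∪_; _∩_; _─_; ⋃)
open import Data.Fin.Subset.Properties using (_⊆?_)
open import Data.Vec using (Vec; []; _∷_; lookup)
open import Data.Vec.Properties using (≡-dec)
open import Data.List using (List; [_]; map; _++_; filter; foldr)
open import Relation.Binary.PropositionalEquality using (_≡_)
open import Relation.Nullary.Decidable using (⌊_⌋; Dec)

-- All sets live inside a common finite ground set Fin n.
-- A family of subsets of Fin n is a (decidable) predicate on Subset n;
-- it is automatically finite.
Family : ℕ → Set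
Family n = Subset n → Bool

infix 4 _∈F_
_∈F_ : ∀ {n} → Subset n → Family n → Set
A ∈F F = F A ≡ true

_≟S_ : ∀ {n} (A B : Subset n) → Dec (A ≡ B)
_≟S_ = ≡-dec BoolP._≟_

-- Enumeration of all subsets of Fin n (each exactly once)
allSubsets : ∀ n → List (Subset n)
allSubsets zero = [ [] ]
allSubsets (suc n) = map (outside ∷_) (allSubsets n) ++ map (inside ∷_) (allSubsets n)

anyF : ∀ {n} → Family n → (Subset n → Bool) → Bool
anyF {n} F p = foldr (λ A b → (F A ∧ p A) Data.Bool.∨ b) false (allSubsets n)

between : ∀ {n} → Subset n → Subset n → Subset n → Bool
between K S A = ⌊ K ⊆? A ⌋ ∧ ⌊ A ⊆? (K ∪ S) ⌋

P : ∀ {n} → Subset n → Subset n → Family n → Family n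
P K S F B = anyF F (λ A → between K S A ∧ ⌊ (A ─ K) ≟S B ⌋)

restrict : ∀ {n} → Subset n → Subset n → Family n → Family n
restrict K S F A = F A ∧ between K S A

bigUnion : ∀ {n} → Family n → Subset n
bigUnion {n} Fc = ⋃ (filter (λ A → Fc A Data.Bool.≟ true) (allSubsets n))

UnionClosed : ∀ {n} → Family n → Set
UnionClosed G = ∀ A B → A ∈F G → B ∈F G → (A ∪ B) ∈F G

UnionClosedFor : ∀ {n} → Family n → Family n → Set
UnionClosedFor G Gc = UnionClosed G × (∀ A B → A ∈F G → B ∈F Gc → (A ∪ B) ∈F G)
  where open import Data.Product using (_×_)

_⊆F_ : ∀ {n} → Family n → Family n → Set
F ⊆F G = ∀ A → A ∈F F → A ∈F G

allFin : ∀ n → List (Fin n)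
allFin n = Data.List.allFin n

weight : ∀ {n} → (Fin n → ℕ) → Subset n → ℕ
weight {n} w A = foldr (λ x s → (if lookup A x then w x else 0) ℕ.+ s) 0 (allFin n)

sumF : ∀ {n} → Family n → (Subset n → ℤ) → ℤ
sumF {n} F f = foldr (λ A s → (if F A then f A else + 0) ℤ.+ s) (+ 0) (allSubsets n)

Disjoint : ∀ {n} → Subset n → Subset n → Set
Disjoint K S = (K ∩ S) ≡ Data.Fin.Subset.⊥

term : ∀ {n} → (Fin n → ℕ) → Subset n → Subset n → ℤ
term w X A = (+ 2) ℤ.* (+ weight w A) ℤ.- (+ weight w X)

-- Everything rests on the description of a member B of P(K,S,F) as
-- B = A ∖ K for a witness A ∈ F with K ⊆ A ⊆ K ∪ S (the lemmas P⁻ / P⁺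
-- turn the Boolean definitions of Defs into this statement).
-- (1) A ⊆ K ∪ S gives A ∖ K ⊆ S.  For (2) take A′ the witness of the second
--   set; for (3) take A′ = C ∈ F_c, for which C ∖ K = C since C ⊆ ⋃F_c = S is
--   disjoint from K.
-- (4) A ↦ A ∖ K is a bijection from the supersets of K onto the subsets of ∁K,
--   with inverse B ↦ B ∪ K.  The corresponding reindexing of sums over all
--   subsets of Fin n holds by induction on n; it is applied to the summand
--   2w(A) − w(X), which is unchanged under A ↦ A ∪ K because w vanishes on K.
module Submission where

open import Defs
open import Data.Nat using (ℕ; zero; suc)
import Data.Nat as ℕ
open import Data.Integer using (ℤ; +_; _+_)
import Data.Integer as ℤ
open import Data.Integer.Properties using (+-identityˡ; +-identityʳ; +-assoc)
open import Data.Bool using (Bool; true; false; if_then_else_; _∧_; _∨_)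
open import Data.Bool.Properties using (∨-identityʳ; T-≡; ⇔→≡)
import Data.Bool as Bool
open import Data.Fin using (Fin)
open import Data.Fin.Subset
  using (Subset; inside; outside; _∈_; _∉_; _⊆_; _⊈_; _∪_; _─_; ∁; ⋃)
open import Data.Fin.Subset.Properties
  using (_⊆?_; ⊆-trans; drop-∷-⊆; out⊆; in⊆in; p⊆p∪q; q⊆p∪q; x∈p∪q⁻; p─q⊆p; x∈p∩q⁺; ∉⊥;
         x∉p⇒x∈∁p; x∈∁p⇒x∉p)
open import Data.Vec using ([]; _∷_; lookup; here; there)
open import Data.Vec.Properties using (lookup-zipWith; lookup⇒[]=)
open import Data.List using (List; []; _∷_; map; _++_; foldr)
open import Data.List.Properties using (foldr-cong; foldr-map)
open import Data.List.Membership.Propositional using () renaming (_∈_ to _∈ₗ_)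
open import Data.List.Relation.Unary.Any using () renaming (here to hereₗ; there to thereₗ)
open import Data.List.Membership.Propositional.Properties using (∈-map⁺; ∈-++⁺ˡ; ∈-++⁺ʳ; ∈-filter⁺)
open import Data.Product using (_×_; _,_; ∃-syntax)
open import Data.Sum using (inj₁; inj₂)
open import Data.Empty using (⊥-elim)
open import Function using (case_of_; _∘_)
open import Function.Bundles using (Equivalence; mk⇔)
open import Relation.Nullary using (Dec; contradiction)
open import Relation.Nullary.Decidable using (⌊_⌋; toWitness; isYes≗does; dec-true)
open import Relation.Binary.PropositionalEquality using (_≡_; refl; sym; trans; cong; cong₂; subst)
open Relation.Binary.PropositionalEquality.≡-Reasoning

private
  variable
    n : ℕ

∧-true⁻ : ∀ {a b : Bool} → a ∧ b ≡ true → a ≡ true × b ≡ true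
∧-true⁻ {true} b≡true = refl , b≡true

∧-true⁺ : ∀ {a b : Bool} → a ≡ true → b ≡ true → a ∧ b ≡ true
∧-true⁺ refl refl = refl

⌊⌋-true⁻ : ∀ {X : Set} (d : Dec X) → ⌊ d ⌋ ≡ true → X
⌊⌋-true⁻ d eq = toWitness {a? = d} (Equivalence.from T-≡ eq)

⌊⌋-true⁺ : ∀ {X : Set} (d : Dec X) → X → ⌊ d ⌋ ≡ true
⌊⌋-true⁺ d x = trans (isYes≗does d) (dec-true d x)

any-true⁻ : ∀ {A : Set} (q : A → Bool) (xs : List A) →
            foldr (λ a b → q a ∨ b) false xs ≡ true → ∃[ a ] q a ≡ true
any-true⁻ q (x ∷ xs) eq with q x in qx
... | true  = x , qx
... | false = any-true⁻ q xs eq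

any-true⁺ : ∀ {A : Set} (q : A → Bool) {xs : List A} {a : A} →
            a ∈ₗ xs → q a ≡ true → foldr (λ a b → q a ∨ b) false xs ≡ true
any-true⁺ q {x ∷ xs} (hereₗ refl) qa rewrite qa = refl
any-true⁺ q {x ∷ xs} (thereₗ a∈xs) qa with q x
... | true  = refl
... | false = any-true⁺ q a∈xs qa

allSubsets-complete : (A : Subset n) → A ∈ₗ allSubsets n
allSubsets-complete []            = hereₗ refl
allSubsets-complete {suc n} (outside ∷ A) = ∈-++⁺ˡ (∈-map⁺ (outside ∷_) (allSubsets-complete A))
allSubsets-complete {suc n} (inside ∷ A)  =
  ∈-++⁺ʳ (map (outside ∷_) (allSubsets n)) (∈-map⁺ (inside ∷_) (allSubsets-complete A))

∪-lub : ∀ {p q r : Subset n} → p ⊆ r → q ⊆ r → p ∪ q ⊆ r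
∪-lub {p = p} {q} p⊆r q⊆r x∈p∪q with x∈p∪q⁻ p q x∈p∪q
... | inj₁ x∈p = p⊆r x∈p
... | inj₂ x∈q = q⊆r x∈q

⊆-⋃ : ∀ {C : Subset n} {xs : List (Subset n)} → C ∈ₗ xs → C ⊆ ⋃ xs
⊆-⋃ {xs = X ∷ xs} (hereₗ refl)  = p⊆p∪q (⋃ xs)
⊆-⋃ {xs = X ∷ xs} (thereₗ C∈xs) = ⊆-trans (⊆-⋃ C∈xs) (q⊆p∪q X (⋃ xs))

─⊆∁ : (p q : Subset n) → p ─ q ⊆ ∁ q
─⊆∁ (s ∷ p)       (outside ∷ q) here       = here
─⊆∁ (s ∷ p)       (_ ∷ q)       (there x∈) = there (─⊆∁ p q x∈)

disjoint⇒⊆∁ : ∀ {K S : Subset n} → Disjoint K S → S ⊆ ∁ K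
disjoint⇒⊆∁ {K = K} {S} K∩S≡∅ {x} x∈S = x∉p⇒x∈∁p x∉K
  where
  x∉K : x ∉ K
  x∉K x∈K = ∉⊥ (subst (x ∈_) K∩S≡∅ (x∈p∩q⁺ (x∈K , x∈S)))

─-distribʳ-∪ : (p q r : Subset n) → (p ∪ q) ─ r ≡ (p ─ r) ∪ (q ─ r)
─-distribʳ-∪ []      []      []            = refl
─-distribʳ-∪ (a ∷ p) (b ∷ q) (outside ∷ r) = cong ((a ∨ b) ∷_) (─-distribʳ-∪ p q r)
─-distribʳ-∪ (a ∷ p) (b ∷ q) (inside ∷ r)  = cong (outside ∷_) (─-distribʳ-∪ p q r)

─-disjoint : (p q : Subset n) → p ⊆ ∁ q → p ─ q ≡ p
─-disjoint []            []            _   = refl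
─-disjoint (a ∷ p)       (outside ∷ q) p⊆ = cong (a ∷_) (─-disjoint p q (drop-∷-⊆ p⊆))
─-disjoint (outside ∷ p) (inside ∷ q)  p⊆ = cong (outside ∷_) (─-disjoint p q (drop-∷-⊆ p⊆))
─-disjoint (inside ∷ p)  (inside ∷ q)  p⊆ = case p⊆ here of λ ()

─-∪-cancel : (p q : Subset n) → q ⊆ p → (p ─ q) ∪ q ≡ p
─-∪-cancel []            []            _   = refl
─-∪-cancel (a ∷ p)       (outside ∷ q) q⊆ = cong₂ _∷_ (∨-identityʳ a) (─-∪-cancel p q (drop-∷-⊆ q⊆))
─-∪-cancel (inside ∷ p)  (inside ∷ q)  q⊆ = cong (inside ∷_) (─-∪-cancel p q (drop-∷-⊆ q⊆))
─-∪-cancel (outside ∷ p) (inside ∷ q)  q⊆ = case q⊆ here of λ ()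

∪-─-cancel : (p q : Subset n) → p ⊆ ∁ q → (p ∪ q) ─ q ≡ p
∪-─-cancel []            []            _   = refl
∪-─-cancel (a ∷ p)       (outside ∷ q) p⊆ = cong₂ _∷_ (∨-identityʳ a) (∪-─-cancel p q (drop-∷-⊆ p⊆))
∪-─-cancel (outside ∷ p) (inside ∷ q)  p⊆ = cong (outside ∷_) (∪-─-cancel p q (drop-∷-⊆ p⊆))
∪-─-cancel (inside ∷ p)  (inside ∷ q)  p⊆ = case p⊆ here of λ ()

Between : Subset n → Subset n → Subset n → Set
Between K S A = K ⊆ A × A ⊆ K ∪ S

between⁻ : ∀ (K S A : Subset n) → between K S A ≡ true → Between K S A
between⁻ K S A eq with ∧-true⁻ eq
... | K⊆A , A⊆K∪S = ⌊⌋-true⁻ (K ⊆? A) K⊆A , ⌊⌋-true⁻ (A ⊆? K ∪ S) A⊆K∪S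

between⁺ : ∀ (K S A : Subset n) → Between K S A → between K S A ≡ true
between⁺ K S A (K⊆A , A⊆K∪S) = ∧-true⁺ (⌊⌋-true⁺ (K ⊆? A) K⊆A) (⌊⌋-true⁺ (A ⊆? K ∪ S) A⊆K∪S)

restrict⁻ : ∀ (K S : Subset n) F A → A ∈F restrict K S F → A ∈F F × Between K S A
restrict⁻ K S F A eq with ∧-true⁻ eq
... | A∈F , bt = A∈F , between⁻ K S A bt

restrict⁺ : ∀ (K S : Subset n) F A → A ∈F F → Between K S A → A ∈F restrict K S F
restrict⁺ K S F A A∈F bt = ∧-true⁺ A∈F (between⁺ K S A bt)

P⁻ : ∀ (K S : Subset n) F B → B ∈F P K S F →
     ∃[ A ] A ∈F F × Between K S A × A ─ K ≡ B
P⁻ K S F B eq with any-true⁻ _ (allSubsets _) eq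
... | A , test with ∧-true⁻ test
...   | A∈F , rest with ∧-true⁻ rest
...     | bt , A─K≡B = A , A∈F , between⁻ K S A bt , ⌊⌋-true⁻ ((A ─ K) ≟S B) A─K≡B

P⁺ : ∀ (K S : Subset n) F A → A ∈F F → Between K S A → (A ─ K) ∈F P K S F
P⁺ K S F A A∈F bt =
  any-true⁺ _ (allSubsets-complete A)
    (∧-true⁺ A∈F (∧-true⁺ (between⁺ K S A bt) (⌊⌋-true⁺ ((A ─ K) ≟S (A ─ K)) refl)))

P⊆S : ∀ (K S : Subset n) F B → B ∈F P K S F → B ⊆ S
P⊆S K S F B B∈P with P⁻ K S F B B∈P
... | A , _ , (_ , A⊆K∪S) , refl = A─K⊆S
  where
  A─K⊆S : A ─ K ⊆ S
  A─K⊆S x∈A─K with x∈p∪q⁻ K S (A⊆K∪S (p─q⊆p A K x∈A─K))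
  ... | inj₁ x∈K = contradiction x∈K (x∈∁p⇒x∉p (─⊆∁ A K x∈A─K))
  ... | inj₂ x∈S = x∈S

P-∪ : ∀ (K S : Subset n) F → UnionClosed F → ∀ B A′ →
      B ∈F P K S F → A′ ∈F F → A′ ⊆ K ∪ S → (B ∪ (A′ ─ K)) ∈F P K S F
P-∪ K S F closed B A′ B∈P A′∈F A′⊆K∪S with P⁻ K S F B B∈P
... | A , A∈F , (K⊆A , A⊆K∪S) , refl =
  subst (_∈F P K S F) (─-distribʳ-∪ A A′ K)
    (P⁺ K S F (A ∪ A′) (closed A A′ A∈F A′∈F)
       (⊆-trans K⊆A (p⊆p∪q A′) , ∪-lub A⊆K∪S A′⊆K∪S))

⊆-bigUnion : ∀ (Fc : Family n) C → C ∈F Fc → C ⊆ bigUnion Fc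
⊆-bigUnion Fc C C∈Fc = ⊆-⋃ (∈-filter⁺ (λ A → Fc A Bool.≟ true) (allSubsets-complete C) C∈Fc)

P-unionClosed : ∀ (K S : Subset n) F → UnionClosed F → UnionClosed (P K S F)
P-unionClosed K S F closed B₁ B₂ B₁∈P B₂∈P with P⁻ K S F B₂ B₂∈P
... | A₂ , A₂∈F , (_ , A₂⊆K∪S) , refl = P-∪ K S F closed B₁ A₂ B₁∈P A₂∈F A₂⊆K∪S

-- Part (3): a member C of F_c lies in S = ⋃ F_c, hence avoids K, so C ∖ K = C.
P-unionClosedFor : ∀ (K S : Subset n) F (Fc : Family n) → UnionClosed F → Fc ⊆F F →
                   S ≡ bigUnion Fc → Disjoint K S → UnionClosedFor (P K S F) Fc
P-unionClosedFor K S F Fc closed Fc⊆F S≡⋃Fc K∩S≡∅ = P-unionClosed K S F closed , adjoin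
  where
  adjoin : ∀ B C → B ∈F P K S F → C ∈F Fc → (B ∪ C) ∈F P K S F
  adjoin B C B∈P C∈Fc =
    subst (λ C′ → (B ∪ C′) ∈F P K S F) (─-disjoint C K (⊆-trans C⊆S (disjoint⇒⊆∁ K∩S≡∅)))
      (P-∪ K S F closed B C B∈P (Fc⊆F C C∈Fc) (⊆-trans C⊆S (q⊆p∪q K S)))
    where
    C⊆S : C ⊆ S
    C⊆S = subst (C ⊆_) (sym S≡⋃Fc) (⊆-bigUnion Fc C C∈Fc)

sumList : ∀ {A : Set} → (A → ℤ) → List A → ℤ
sumList g xs = foldr (λ a s → g a + s) (+ 0) xs

ΣSub : ∀ n → (Subset n → ℤ) → ℤ
ΣSub n g = sumList g (allSubsets n)

masked : Family n → (Subset n → ℤ) → Subset n → ℤ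
masked F f A = if F A then f A else + 0

sumList-++ : ∀ {A : Set} (g : A → ℤ) xs ys → sumList g (xs ++ ys) ≡ sumList g xs + sumList g ys
sumList-++ g []       ys = sym (+-identityˡ _)
sumList-++ g (x ∷ xs) ys = begin
  g x + sumList g (xs ++ ys)            ≡⟨ cong (_+_ (g x)) (sumList-++ g xs ys) ⟩
  g x + (sumList g xs + sumList g ys)   ≡⟨ sym (+-assoc (g x) _ _) ⟩
  (g x + sumList g xs) + sumList g ys   ∎

sumList-zero : ∀ {A : Set} (g : A → ℤ) → (∀ a → g a ≡ + 0) → ∀ xs → sumList g xs ≡ + 0
sumList-zero g g≡0 []       = refl
sumList-zero g g≡0 (x ∷ xs) = cong₂ _+_ (g≡0 x) (sumList-zero g g≡0 xs)

ΣSub-split : ∀ n (g : Subset (suc n) → ℤ) →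
             ΣSub (suc n) g ≡ ΣSub n (g ∘ (outside ∷_)) + ΣSub n (g ∘ (inside ∷_))
ΣSub-split n g = begin
  sumList g (map (outside ∷_) (allSubsets n) ++ map (inside ∷_) (allSubsets n))
    ≡⟨ sumList-++ g (map (outside ∷_) (allSubsets n)) _ ⟩
  sumList g (map (outside ∷_) (allSubsets n)) + sumList g (map (inside ∷_) (allSubsets n))
    ≡⟨ cong₂ _+_ (foldr-map _ (outside ∷_) (+ 0) (allSubsets n)) (foldr-map _ (inside ∷_) (+ 0) (allSubsets n)) ⟩
  ΣSub n (g ∘ (outside ∷_)) + ΣSub n (g ∘ (inside ∷_)) ∎

ΣSub-shift : ∀ n (K : Subset n) (g h : Subset n → ℤ) →
             (∀ A → K ⊈ A → g A ≡ + 0) → (∀ B → B ⊈ ∁ K → h B ≡ + 0) →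
             (∀ B → B ⊆ ∁ K → g (B ∪ K) ≡ h B) → ΣSub n g ≡ ΣSub n h
ΣSub-shift zero [] g h _ _ g≡h = cong (λ t → t + + 0) (g≡h [] λ ())
ΣSub-shift (suc n) (outside ∷ K) g h g-supp h-supp g≡h = begin
  ΣSub (suc n) g                                       ≡⟨ ΣSub-split n g ⟩
  ΣSub n (g ∘ (outside ∷_)) + ΣSub n (g ∘ (inside ∷_))
    ≡⟨ cong₂ _+_
         (ΣSub-shift n K _ _ (λ A K⊈A → g-supp _ (K⊈A ∘ drop-∷-⊆)) (λ B B⊈ → h-supp _ (B⊈ ∘ drop-∷-⊆))
            (λ B B⊆ → g≡h _ (out⊆ B⊆)))
         (ΣSub-shift n K _ _ (λ A K⊈A → g-supp _ (K⊈A ∘ drop-∷-⊆)) (λ B B⊈ → h-supp _ (B⊈ ∘ drop-∷-⊆))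
            (λ B B⊆ → g≡h _ (in⊆in B⊆))) ⟩
  ΣSub n (h ∘ (outside ∷_)) + ΣSub n (h ∘ (inside ∷_)) ≡⟨ sym (ΣSub-split n h) ⟩
  ΣSub (suc n) h                                       ∎
ΣSub-shift (suc n) (inside ∷ K) g h g-supp h-supp g≡h = begin
  ΣSub (suc n) g                                       ≡⟨ ΣSub-split n g ⟩
  ΣSub n (g ∘ (outside ∷_)) + ΣSub n (g ∘ (inside ∷_))
    ≡⟨ cong (λ t → t + ΣSub n (g ∘ (inside ∷_)))
         (sumList-zero _ (λ A → g-supp _ λ K⊆ → case K⊆ here of λ ()) (allSubsets n)) ⟩
  + 0 + ΣSub n (g ∘ (inside ∷_))                     ≡⟨ +-identityˡ _ ⟩
  ΣSub n (g ∘ (inside ∷_))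
    ≡⟨ ΣSub-shift n K _ _ (λ A K⊈A → g-supp _ (K⊈A ∘ drop-∷-⊆)) (λ B B⊈ → h-supp _ (B⊈ ∘ drop-∷-⊆))
         (λ B B⊆ → g≡h _ (out⊆ B⊆)) ⟩
  ΣSub n (h ∘ (outside ∷_))                            ≡⟨ sym (+-identityʳ _) ⟩
  ΣSub n (h ∘ (outside ∷_)) + + 0
    ≡⟨ cong (_+_ (ΣSub n (h ∘ (outside ∷_))))
         (sym (sumList-zero _ (λ B → h-supp _ λ B⊆ → case B⊆ here of λ ()) (allSubsets n))) ⟩
  ΣSub n (h ∘ (outside ∷_)) + ΣSub n (h ∘ (inside ∷_)) ≡⟨ sym (ΣSub-split n h) ⟩
  ΣSub (suc n) h                                       ∎

-- Part (4) for any summand f that is unchanged by adjoining K to a set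
-- disjoint from K: B ↦ B ∪ K matches the members of P(K,S,F) with those of
-- { A ∈ F : K ⊆ A ⊆ K ∪ S }.
sum-restrict≡sum-P : ∀ (K S : Subset n) F (f : Subset n → ℤ) →
                     (∀ B → B ⊆ ∁ K → f (B ∪ K) ≡ f B) →
                     sumF (restrict K S F) f ≡ sumF (P K S F) f
sum-restrict≡sum-P {n} K S F f f-invariant =
  ΣSub-shift n K (masked (restrict K S F) f) (masked (P K S F) f) restrict-support P-support shift
  where
  restrict-support : ∀ A → K ⊈ A → masked (restrict K S F) f A ≡ + 0
  restrict-support A K⊈A with restrict K S F A in A∈R
  ... | false = refl
  ... | true with restrict⁻ K S F A A∈R
  ...   | _ , (K⊆A , _) = ⊥-elim (K⊈A K⊆A)

  P-support : ∀ B → B ⊈ ∁ K → masked (P K S F) f B ≡ + 0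
  P-support B B⊈∁K with P K S F B in B∈P
  ... | false = refl
  ... | true with P⁻ K S F B B∈P
  ...   | A , _ , _ , refl = ⊥-elim (B⊈∁K (─⊆∁ A K))

  -- B ∪ K is a witness for B, and every witness for B equals B ∪ K.
  same-membership : ∀ B → B ⊆ ∁ K → restrict K S F (B ∪ K) ≡ P K S F B
  same-membership B B⊆∁K = ⇔→≡ {z = true} (mk⇔ witness unique-witness)
    where
    witness : (B ∪ K) ∈F restrict K S F → B ∈F P K S F
    witness B∪K∈R with restrict⁻ K S F (B ∪ K) B∪K∈R
    ... | B∪K∈F , bt = subst (_∈F P K S F) (∪-─-cancel B K B⊆∁K) (P⁺ K S F (B ∪ K) B∪K∈F bt)

    unique-witness : B ∈F P K S F → (B ∪ K) ∈F restrict K S F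
    unique-witness B∈P with P⁻ K S F B B∈P
    ... | A , A∈F , bt@(K⊆A , _) , refl =
      subst (_∈F restrict K S F) (sym (─-∪-cancel A K K⊆A)) (restrict⁺ K S F A A∈F bt)

  shift : ∀ B → B ⊆ ∁ K → masked (restrict K S F) f (B ∪ K) ≡ masked (P K S F) f B
  shift B B⊆∁K = cong₂ (λ b v → if b then v else + 0) (same-membership B B⊆∁K) (f-invariant B B⊆∁K)

weight-∪-null : ∀ (w : Fin n → ℕ) (K : Subset n) → (∀ x → x ∈ K → w x ≡ 0) →
                ∀ B → weight w (B ∪ K) ≡ weight w B
weight-∪-null {n} w K w-null B = foldr-cong (λ x s → cong (ℕ._+ s) (contribution x)) refl (allFin n)
  where
  contribution : ∀ x → (if lookup (B ∪ K) x then w x else 0) ≡ (if lookup B x then w x else 0)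
  contribution x rewrite lookup-zipWith _∨_ x B K with lookup B x | lookup K x in x∈K
  ... | true  | _     = refl
  ... | false | false = refl
  ... | false | true  = w-null x (lookup⇒[]= x K x∈K)

proposition6 : ∀ (n : ℕ) (K S : Subset n) (F : Family n) →
      -- (1)
      (Disjoint K S → ∀ (K′ : Subset n) → K′ ⊆ K → ∀ B → B ∈F P K′ S F → B ⊆ S)
    × -- (2)
      (UnionClosed F → UnionClosed (P K S F))
    × -- (3)
      (∀ (Fc : Family n) → UnionClosed F → Fc ⊆F F → S ≡ bigUnion Fc → Disjoint K S →
         UnionClosedFor (P K S F) Fc)
    × -- (4)
      (∀ (w : Fin n → ℕ) → (∀ x → x ∈ K → w x ≡ 0) → ∀ (X : Subset n) →
         sumF (restrict K S F) (term w X) ≡ sumF (P K S F) (term w X))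
proposition6 n K S F =
    (λ _ K′ _ → P⊆S K′ S F)
  , P-unionClosed K S F
  , P-unionClosedFor K S F
  , λ w w-null X → sum-restrict≡sum-P K S F (term w X)
      (λ B _ → cong (λ m → + 2 ℤ.* + m ℤ.- + weight w X) (weight-∪-null w K w-null B))
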